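{- For $m=3$, \[ A^{(3)}(x)=\frac{N_3(x)}{D_3(x)}, \] where \[ N_3(x)=1-x-x^2+x^3+4x^4-4x^6-3x^7-3x^8-5x^9-3x^{10}+2x^{11}+2x^{12}, \] \[ D_3(x)=1-2x-x^2+x^3+x^4+2x^5+2x^6+2x^7-4x^8-2x^9+x^{10}-2x^{11}+x^{13}. \] Consequently, for $n\ge13$, \[ a_n^{(3)}=2a_{n-1}^{(3)}+a_{n-2}^{(3)}-a_{n-3}^{(3)}-a_{n-4}^{(3)}-2a_{n-5}^{(3)}-2a_{n-6}^{(3)}-2a_{n-7}^{(3)}+4a_{n-8}^{(3)}+2a_{n-9}^{(3)}-a_{n-10}^{(3)}+2a_{n-11}^{(3)}-a_{n-13}^{(3)}. \]
   Context: A permutation $\pi\in S_n$ avoids $132$ if there are no indices $i<j<k$ with $\pi_i<\pi_k<\pi_j$. For fixed $m\ge1$, $a_n^{(m)}$ is the number of $132$-avoiding $\pi\in S_n$ with $|\pi_{i+1}-\pi_i|\le m$ for all $1\le i<n$, with $a_0^{(m)}=1$ (empty permutation), and $A^{(m)}(x)=\sum_{n\ge0}a_n^{(m)}x^n$. -}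

module Defs where

open import Data.Nat using (ℕ; zero; suc; _<_; _≤_; ∣_-_∣)
open import Data.Fin using (Fin; toℕ) renaming (_<_ to _<ᶠ_)
open import Data.List using (List; []; _∷_; length; lookup; upTo)
open import Data.List.Relation.Binary.Permutation.Propositional using (_↭_)
open import Data.Product using (_×_)
open import Relation.Nullary using (¬_)
open import Relation.Binary.PropositionalEquality using (_≡_)
open import Data.Integer using (ℤ; +_; -_; _+_; _*_)

-- A permutation of length n is represented in one-line notation as a list
-- that is a rearrangement of [0, 1, ..., n-1]  (values shifted by -1, which
-- changes neither pattern containment nor adjacent differences).
IsPerm : ℕ → List ℕ → Set
IsPerm n σ = σ ↭ upTo n

Avoids132 : List ℕ → Set
Avoids132 σ = (i j k : Fin (length σ)) → i <ᶠ j → j <ᶠ k →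
  ¬ ((lookup σ i < lookup σ k) × (lookup σ k < lookup σ j))

AdjBounded : ℕ → List ℕ → Set
AdjBounded m σ = (i j : Fin (length σ)) → toℕ j ≡ suc (toℕ i) →
  ∣ lookup σ j - lookup σ i ∣ ≤ m

Valid : ℕ → ℕ → List ℕ → Set
Valid m n σ = IsPerm n σ × Avoids132 σ × AdjBounded m σ

coeff : List ℤ → ℕ → ℤ
coeff [] n = + 0
coeff (c ∷ cs) zero = c
coeff (c ∷ cs) (suc n) = coeff cs n

-- Coefficient of x^n in P(x) · F(x), P a polynomial (coefficient list),
-- F a formal power series given by its coefficient sequence.
conv : List ℤ → (ℕ → ℤ) → ℕ → ℤ
conv [] f n = + 0
conv (d ∷ ds) f zero = d * f zero
conv (d ∷ ds) f (suc n) = d * f (suc n) + conv ds f n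

N3 : List ℤ
N3 = + 1 ∷ - + 1 ∷ - + 1 ∷ + 1 ∷ + 4 ∷ + 0 ∷ - + 4 ∷ - + 3 ∷ - + 3 ∷ - + 5 ∷ - + 3 ∷ + 2 ∷ + 2 ∷ []

D3 : List ℤ
D3 = + 1 ∷ - + 2 ∷ - + 1 ∷ + 1 ∷ + 1 ∷ + 2 ∷ + 2 ∷ + 2 ∷ - + 4 ∷ - + 2 ∷ + 1 ∷ - + 2 ∷ + 0 ∷ + 1 ∷ []

{-# OPTIONS --safe #-}
-- Cut a permutation counted by a⁽³⁾ at its maximum k: σ = α ++ k ∷ β.  Avoiding 132 forces every
-- entry of α above every entry of β, so both pieces are again such permutations of intervals.
-- Adjacent differences ≤ 3 put the entry after k at k ∸ 3 or higher, which leaves five shapes;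
-- the pieces recur with their first and last entries confined to the top one, two or three
-- values, and 14 such windowed counts evolve under a fixed linear map.  D₃ annihilates the first
-- coordinate of the powers of that map (a finite computation), which gives the
-- generating-function identity from n = 16 on; below 16 its coefficients are computed.  The
-- recurrence is that identity read off coefficientwise.
module Submission where

open import Defs

module Transfer where

  open import Data.Fin.Base using (Fin)
  open import Data.List.Base using (List; []; _∷_)
  open import Data.List.NonEmpty using (List⁺; _∷_)
  open import Data.Nat.Base using (ℕ)
  open import Data.Vec.Base using (Vec; lookup; map)
  open import Data.Vec.Properties using (map-∘; map-cong; lookup-map)
  open import Function using (_∘_)
  open import Relation.Binary.PropositionalEquality using (_≡_; sym; trans; cong₂)

  private variable
    A B : Set
    m n : ℕ

  sumFrom : (A → A → A) → Vec A n → Fin n → List (Fin n) → A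
  sumFrom _⊕_ v i []       = lookup v i
  sumFrom _⊕_ v i (j ∷ js) = lookup v i ⊕ sumFrom _⊕_ v j js

  transfer : Vec (List⁺ (Fin n)) m → (A → A → A) → Vec A n → Vec A m
  transfer T _⊕_ v = map (λ (i ∷ is) → sumFrom _⊕_ v i is) T

  transfer-hom : ∀ (T : Vec (List⁺ (Fin n)) m) {_⊕_ : A → A → A} {_⊞_ : B → B → B} (f : A → B) →
                 (∀ a b → f (a ⊕ b) ≡ f a ⊞ f b) → ∀ v → map f (transfer T _⊕_ v) ≡ transfer T _⊞_ (map f v)
  transfer-hom T {_⊕_} {_⊞_} f hom v = trans (sym (map-∘ f _ T)) (map-cong (λ (i ∷ is) → row i is) T)
    where
    row : ∀ i is → f (sumFrom _⊕_ v i is) ≡ sumFrom _⊞_ (map f v) i is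
    row i []       = sym (lookup-map i f v)
    row i (j ∷ js) = trans (hom _ _) (cong₂ _⊞_ (sym (lookup-map i f v)) (row j js))

module Enumeration where

  open import Data.Bool.Base using (if_then_else_; true; false; T)
  open import Data.Empty using (⊥; ⊥-elim)
  open import Data.Fin using (Fin; zero; suc; toℕ; #_)
  open import Data.List.Base using (List; []; _∷_; [_]; _++_; _∷ʳ_; map; length; lookup)
  open import Data.List.Membership.Propositional using (_∈_; _∉_)
  open import Data.List.Membership.Propositional.Properties
    using (∈-++⁺ˡ; ∈-++⁺ʳ; ∈-++⁻; ∈-map⁺; ∈-map⁻; ∈-∃++; ∈-lookup; ∈-upTo⁺; ∈-upTo⁻)
  open import Data.List.Membership.Propositional.Properties.WithK using (unique∧set⇒bag)
  open import Data.List.Relation.Binary.BagAndSetEquality using (∼bag⇒↭)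
  open import Data.List.Relation.Binary.Permutation.Propositional using (_↭_; ↭-refl; ↭-sym; ↭⇒↭ₛ)
  open import Data.List.Relation.Binary.Permutation.Propositional.Properties using (∈-resp-↭; ↭-empty-inv)
  import Data.List.Relation.Binary.Permutation.Setoid.Properties as Permutationₛ
  open import Data.List.Relation.Binary.Disjoint.Propositional using (Disjoint)
  open import Data.List.Relation.Unary.All using (All; []; _∷_)
  import Data.List.Relation.Unary.All as All
  open import Data.List.Relation.Unary.All.Properties using (All¬⇒¬Any; ++⁻)
  open import Data.List.Relation.Unary.Any using (here; there; index)
  open import Data.List.Relation.Unary.Any.Properties using (lookup-index)
  open import Data.List.Relation.Unary.Linked using (Linked; []; [-]; _∷_)
  import Data.List.Relation.Unary.Linked as Linked
  open import Data.List.Relation.Unary.Unique.Propositional using (Unique; []; _∷_)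
  import Data.List.Relation.Unary.Unique.Propositional.Properties as Unique
  open import Data.List.Properties using (++-cancelˡ; ∷ʳ-injectiveˡ; ++-assoc; length-++; length-map)
  open import Data.List.NonEmpty using (List⁺; _∷_)
  open import Data.Nat.Base
  open import Data.Nat.GeneralisedArithmetic using (fold)
  open import Data.Nat.Induction using (<-rec)
  open import Data.Nat.Properties
  open import Data.Product using (_×_; _,_; proj₁; proj₂; ∃-syntax)
  open import Data.Sum using (_⊎_; inj₁; inj₂)
  open import Data.Unit using (⊤; tt)
  open import Data.Vec.Base using (Vec; []; _∷_)
  open Transfer using (transfer)
  open import Function using (_∘_; id; _⇔_; mk⇔; Equivalence)
  open import Relation.Binary.Definitions using (tri<; tri≈; tri>)
  open import Relation.Binary.PropositionalEquality hiding ([_])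
  open import Relation.Nullary.Decidable using (yes; no)
  open import Relation.Nullary.Negation using (¬_; contradiction)

  private variable
    A B : Set
    a b c j k m s lo x y : ℕ
    xs ys α β σ : List ℕ

  -- `top c` confines an entry of a permutation of [0, k) to its c largest values k ∸ c, …, k ∸ 1;
  -- `Reaches w j` says that w contains the j-th largest value.
  data Window : Set where
    whole : Window
    top   : ℕ → Window

  private variable
    h l : Window
    xss yss zss : List (List ℕ)

  InWindow : Window → ℕ → ℕ → Set
  InWindow whole   k x = ⊤
  InWindow (top c) k x = k ≤ c + x

  Reaches : Window → ℕ → Set
  Reaches whole   j = ⊤
  Reaches (top c) j = j ≤ c

  shrink : ℕ → Window → Window
  shrink j whole   = whole
  shrink j (top c) = top (c ∸ j)

  ifReaches : Window → ℕ → List A → List A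
  ifReaches whole   j xs = xs
  ifReaches (top c) j xs = if j ≤ᵇ c then xs else []

  ∈-ifReaches⁻ : ∀ w j {xs : List A} {x} → x ∈ ifReaches w j xs → Reaches w j × x ∈ xs
  ∈-ifReaches⁻ whole   j p = tt , p
  ∈-ifReaches⁻ (top c) j p with j ≤ᵇ c in eq
  ... | true  = ≤ᵇ⇒≤ j c (subst T (sym eq) tt) , p
  ... | false with () ← p

  ∈-ifReaches⁺ : ∀ w {j} {xs : List A} {x} → Reaches w j → x ∈ xs → x ∈ ifReaches w j xs
  ∈-ifReaches⁺ whole       r p = p
  ∈-ifReaches⁺ (top c) {j} r p with j ≤ᵇ c in eq
  ... | true  = p
  ... | false = contradiction (subst T eq (≤⇒≤ᵇ r)) λ ()

  ifReaches⁺ : ∀ w j {xs : List A} → Unique xs → Unique (ifReaches w j xs)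
  ifReaches⁺ whole   j u = u
  ifReaches⁺ (top c) j u with j ≤ᵇ c
  ... | true  = u
  ... | false = []

  ifReaches-map : ∀ w j (f : A → B) xs → ifReaches w j (map f xs) ≡ map f (ifReaches w j xs)
  ifReaches-map whole   j f xs = refl
  ifReaches-map (top c) j f xs with j ≤ᵇ c
  ... | true  = refl
  ... | false = refl

  Reaches⇒InWindow : ∀ w {j} x → Reaches w j → InWindow w (j + x) x
  Reaches⇒InWindow whole   x r = tt
  Reaches⇒InWindow (top c) x r = +-monoˡ-≤ x r

  InWindow⇒Reaches : ∀ w {j} x → InWindow w (j + x) x → Reaches w j
  InWindow⇒Reaches whole   x p = tt
  InWindow⇒Reaches (top c) x p = +-cancelʳ-≤ x _ c p

  InWindow-shrink⁺ : ∀ w j {k x} → x < k → InWindow (shrink j w) k x → InWindow w (j + k) x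
  InWindow-shrink⁺ whole   j x<k p = tt
  InWindow-shrink⁺ (top c) j {k} {x} x<k p = go j c p
    where
    go : ∀ j c → k ≤ (c ∸ j) + x → j + k ≤ c + x
    go zero    c       p = p
    go (suc j) zero    p = contradiction p (<⇒≱ x<k)
    go (suc j) (suc c) p = s≤s (go j c p)

  InWindow-shrink⁻ : ∀ w j {k x} → InWindow w (j + k) x → InWindow (shrink j w) k x
  InWindow-shrink⁻ whole   j p = tt
  InWindow-shrink⁻ (top c) j {k} {x} p = go j c p
    where
    go : ∀ j c → j + k ≤ c + x → k ≤ (c ∸ j) + x
    go zero    c       p = p
    go (suc j) zero    p = ≤-trans (m≤n+m k j) (≤-trans (n≤1+n _) p)
    go (suc j) (suc c) p = go j c (s≤s⁻¹ p)

  -- A record rather than a definition, so that unification never unfolds it to ∣ y - x ∣ ≤ m.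
  record Near (m x y : ℕ) : Set where
    constructor near
    field distance : ∣ y - x ∣ ≤ m

  Near-sym : Near m x y → Near m y x
  Near-sym {m} {x} {y} (near d) = near (subst (_≤ m) (∣-∣-comm y x) d)

  Near-+ : ∀ d x → d ≤ m → Near m x (d + x)
  Near-+ {m} d x d≤m =
    near (subst (_≤ m) (sym (trans (m≤n⇒∣n-m∣≡n∸m (m≤n+m x d)) (m+n∸n≡m d x))) d≤m)

  ≤⇒Near : x ≤ y → y ≤ m + x → Near m x y
  ≤⇒Near {x} {y} {m} x≤y y≤m+x =
    near (subst (_≤ m) (sym (m≤n⇒∣n-m∣≡n∸m x≤y)) (m≤n+o⇒m∸n≤o y x (subst (y ≤_) (+-comm m x) y≤m+x)))

  Near-down : y < x → x ≤ m + y → Near m x y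
  Near-down y<x x≤m+y = Near-sym (≤⇒Near (<⇒≤ y<x) x≤m+y)

  Near⇒≤ : Near m x y → y ≤ m + x
  Near⇒≤ {m} {x} {y} (near d) =
    ≤-trans (m≤n+∣m-n∣ y x) (≤-trans (+-monoʳ-≤ x d) (≤-reflexive (+-comm x m)))

  First : (ℕ → Set) → List ℕ → Set
  First P []      = ⊥
  First P (x ∷ _) = P x

  Last : (ℕ → Set) → List ℕ → Set
  Last P []          = ⊥
  Last P (x ∷ [])    = P x
  Last P (_ ∷ y ∷ σ) = Last P (y ∷ σ)

  Last-const : ∀ {P : ℕ → Set} → (∀ {x} → P x) → ∀ x σ → Last P (x ∷ σ)
  Last-const p x []      = p
  Last-const p x (y ∷ σ) = Last-const p y σ

  Last⇒∈ : ∀ {P : ℕ → Set} σ → Last P σ → ∃[ x ] x ∈ σ × P x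
  Last⇒∈ (x ∷ [])    p = x , here refl , p
  Last⇒∈ (x ∷ y ∷ σ) p = let z , z∈ , pz = Last⇒∈ (y ∷ σ) p in z , there z∈ , pz

  Last-mapWith∈ : ∀ {P Q : ℕ → Set} σ → (∀ {x} → x ∈ σ → P x → Q x) → Last P σ → Last Q σ
  Last-mapWith∈ (x ∷ [])    f p = f (here refl) p
  Last-mapWith∈ (x ∷ y ∷ σ) f p = Last-mapWith∈ (y ∷ σ) (f ∘ there) p

  Last-++⁺ : ∀ {P : ℕ → Set} α → Last P (y ∷ ys) → Last P (α ++ y ∷ ys)
  Last-++⁺ []          p = p
  Last-++⁺ (a ∷ [])    p = p
  Last-++⁺ (a ∷ b ∷ α) p = Last-++⁺ (b ∷ α) p

  Last-++⁻ : ∀ {P : ℕ → Set} α → Last P (α ++ y ∷ ys) → Last P (y ∷ ys)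
  Last-++⁻ []          p = p
  Last-++⁻ (a ∷ [])    p = p
  Last-++⁻ (a ∷ b ∷ α) p = Last-++⁻ (b ∷ α) p

  Linked-∷ʳ⁺ : ∀ {R : ℕ → ℕ → Set} α → Linked R α → Last (λ x → R x y) α → Linked R (α ∷ʳ y)
  Linked-∷ʳ⁺ (x ∷ [])    [-]     r = r ∷ [-]
  Linked-∷ʳ⁺ (x ∷ z ∷ α) (r ∷ l) p = r ∷ Linked-∷ʳ⁺ (z ∷ α) l p

  Linked-∷ʳ⁻ : ∀ {R : ℕ → ℕ → Set} x α → Linked R ((x ∷ α) ∷ʳ y) →
               Linked R (x ∷ α) × Last (λ z → R z y) (x ∷ α)
  Linked-∷ʳ⁻ x []      (r ∷ [-]) = [-] , r
  Linked-∷ʳ⁻ x (z ∷ α) (r ∷ l)   = let l′ , p = Linked-∷ʳ⁻ z α l in r ∷ l′ , p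

  Linked-∷ʳ-++ : ∀ {R : ℕ → ℕ → Set} α → Linked R (α ∷ʳ y) → Linked R (y ∷ ys) → Linked R (α ++ y ∷ ys)
  Linked-∷ʳ-++ []          _         l = l
  Linked-∷ʳ-++ (x ∷ [])    (r ∷ [-]) l = r ∷ l
  Linked-∷ʳ-++ (x ∷ z ∷ α) (r ∷ lα)  l = r ∷ Linked-∷ʳ-++ (z ∷ α) lα l

  Linked-++⁻ʳ : ∀ {R : ℕ → ℕ → Set} α → Linked R (α ++ ys) → Linked R ys
  Linked-++⁻ʳ []      l = l
  Linked-++⁻ʳ (x ∷ α) l = Linked-++⁻ʳ α (Linked.tail l)

  data Occurs₂ : ℕ → ℕ → List ℕ → Set where
    here₂  : c ∈ xs → Occurs₂ b c (b ∷ xs)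
    there₂ : Occurs₂ b c xs → Occurs₂ b c (y ∷ xs)

  data Occurs₃ : ℕ → ℕ → ℕ → List ℕ → Set where
    here₃  : Occurs₂ b c xs → Occurs₃ a b c (a ∷ xs)
    there₃ : Occurs₃ a b c xs → Occurs₃ a b c (y ∷ xs)

  Avoids132′ : List ℕ → Set
  Avoids132′ σ = ∀ {a b c} → Occurs₃ a b c σ → a < c → c < b → ⊥

  Occurs₂⇒∈ : Occurs₂ b c xs → c ∈ xs
  Occurs₂⇒∈ (here₂ p)  = there p
  Occurs₂⇒∈ (there₂ o) = there (Occurs₂⇒∈ o)

  Occurs₂-++⁺ˡ : ∀ ys → Occurs₂ b c xs → Occurs₂ b c (xs ++ ys)
  Occurs₂-++⁺ˡ ys (here₂ p)  = here₂ (∈-++⁺ˡ p)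
  Occurs₂-++⁺ˡ ys (there₂ o) = there₂ (Occurs₂-++⁺ˡ ys o)

  Occurs₂-++⁻ : ∀ xs → Occurs₂ b c (xs ++ ys) → Occurs₂ b c xs ⊎ (b ∈ xs × c ∈ ys) ⊎ Occurs₂ b c ys
  Occurs₂-++⁻ []       o = inj₂ (inj₂ o)
  Occurs₂-++⁻ (x ∷ xs) (here₂ p) with ∈-++⁻ xs p
  ... | inj₁ q = inj₁ (here₂ q)
  ... | inj₂ q = inj₂ (inj₁ (here refl , q))
  Occurs₂-++⁻ (x ∷ xs) (there₂ o) with Occurs₂-++⁻ xs o
  ... | inj₁ r             = inj₁ (there₂ r)
  ... | inj₂ (inj₁ (p , q)) = inj₂ (inj₁ (there p , q))
  ... | inj₂ (inj₂ r)       = inj₂ (inj₂ r)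

  Occurs₃-++⁺ˡ : ∀ ys → Occurs₃ a b c xs → Occurs₃ a b c (xs ++ ys)
  Occurs₃-++⁺ˡ ys (here₃ o)  = here₃ (Occurs₂-++⁺ˡ ys o)
  Occurs₃-++⁺ˡ ys (there₃ o) = there₃ (Occurs₃-++⁺ˡ ys o)

  Occurs₃-++⁺ʳ : ∀ xs → Occurs₃ a b c ys → Occurs₃ a b c (xs ++ ys)
  Occurs₃-++⁺ʳ []       o = o
  Occurs₃-++⁺ʳ (x ∷ xs) o = there₃ (Occurs₃-++⁺ʳ xs o)

  Occurs₃-++-∷ : ∀ α → a ∈ α → c ∈ β → Occurs₃ a m c (α ++ m ∷ β)
  Occurs₃-++-∷ (x ∷ α) (here refl) q = here₃ (go α)
    where
    go : ∀ α → Occurs₂ _ _ (α ++ _ ∷ _)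
    go []      = here₂ q
    go (x ∷ α) = there₂ (go α)
  Occurs₃-++-∷ (x ∷ α) (there p) q = there₃ (Occurs₃-++-∷ α p q)

  Occurs₂-∷⇒∈ : Occurs₂ b c (y ∷ ys) → c ∈ ys
  Occurs₂-∷⇒∈ (here₂ p)  = p
  Occurs₂-∷⇒∈ (there₂ o) = Occurs₂⇒∈ o

  Avoids132′-++-∷ : ∀ α → Avoids132′ α → Avoids132′ β → (∀ {a b} → a ∈ α → b ∈ β → b < a) →
                    (∀ {a} → a ∈ α → a < m) → (∀ {b} → b ∈ β → b < m) → Avoids132′ (α ++ m ∷ β)
  Avoids132′-++-∷ [] avα avβ β<α α<m β<m (here₃ o)  a<c c<b = <-asym a<c (β<m (Occurs₂⇒∈ o))
  Avoids132′-++-∷ [] avα avβ β<α α<m β<m (there₃ o) a<c c<b = avβ o a<c c<b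
  Avoids132′-++-∷ (x ∷ α) avα avβ β<α α<m β<m (there₃ o) =
    Avoids132′-++-∷ α (avα ∘ there₃) avβ (β<α ∘ there) (α<m ∘ there) β<m o
  Avoids132′-++-∷ (x ∷ α) avα avβ β<α α<m β<m (here₃ o) a<c c<b with Occurs₂-++⁻ α o
  ... | inj₁ o′                        = avα (here₃ o′) a<c c<b
  ... | inj₂ (inj₁ (b∈α , here refl)) = <-asym c<b (α<m (there b∈α))
  ... | inj₂ (inj₁ (b∈α , there c∈β)) = <-asym a<c (β<α (here refl) c∈β)
  ... | inj₂ (inj₂ o′)                 = <-asym a<c (β<α (here refl) (Occurs₂-∷⇒∈ o′))

  Unique-++⁻ : ∀ xs → Unique (xs ++ ys) → Unique xs × Unique ys × Disjoint xs ys
  Unique-++⁻ []       u          = [] , u , λ { (() , _) }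
  Unique-++⁻ (x ∷ xs) (x∉ ∷ u) with Unique-++⁻ xs u | ++⁻ xs x∉
  ... | uxs , uys , disjoint | x∉xs , x∉ys = x∉xs ∷ uxs , uys , λ where
    (here refl , q) → All¬⇒¬Any x∉ys q
    (there p   , q) → disjoint (p , q)

  record Arranges (lo hi : ℕ) (σ : List ℕ) : Set where
    field
      unique : Unique σ
      bounds : ∀ {x} → x ∈ σ → lo ≤ x × x < hi
      covers : ∀ {x} → lo ≤ x → x < hi → x ∈ σ
      avoids : Avoids132′ σ
  open Arranges

  Arranges-[] : Arranges s s []
  Arranges-[] = record
    { unique = []
    ; bounds = λ ()
    ; covers = λ s≤x x<s → contradiction s≤x (<⇒≱ x<s)
    ; avoids = λ ()
    }

  Arranges-++-∷⁺ : lo ≤ s → s ≤ k → Arranges s k α → Arranges lo s β → Arranges lo (suc k) (α ++ k ∷ β)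
  Arranges-++-∷⁺ {lo} {s} {k} {α} {β} lo≤s s≤k A B = record
    { unique = Unique.++⁺ (unique A) (All.tabulate (>⇒≢ ∘ β<k) ∷ unique B) disjoint
    ; bounds = bounds′
    ; covers = covers′
    ; avoids = Avoids132′-++-∷ α (avoids A) (avoids B) β<α α<k β<k
    }
    where
    α<k : ∀ {a} → a ∈ α → a < k
    α<k = proj₂ ∘ bounds A
    β<s : ∀ {b} → b ∈ β → b < s
    β<s = proj₂ ∘ bounds B
    β<k : ∀ {b} → b ∈ β → b < k
    β<k q = <-≤-trans (β<s q) s≤k
    β<α : ∀ {a b} → a ∈ α → b ∈ β → b < a
    β<α p q = <-≤-trans (β<s q) (proj₁ (bounds A p))
    disjoint : Disjoint α (k ∷ β)
    disjoint (p , here refl) = <-irrefl refl (α<k p)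
    disjoint (p , there q)   = <-irrefl refl (β<α p q)
    bounds′ : ∀ {x} → x ∈ α ++ k ∷ β → lo ≤ x × x < suc k
    bounds′ p with ∈-++⁻ α p
    ... | inj₁ q         = ≤-trans lo≤s (proj₁ (bounds A q)) , m≤n⇒m≤1+n (α<k q)
    ... | inj₂ (here refl) = ≤-trans lo≤s s≤k , n<1+n k
    ... | inj₂ (there q) = proj₁ (bounds B q) , m≤n⇒m≤1+n (β<k q)
    covers′ : ∀ {x} → lo ≤ x → x < suc k → x ∈ α ++ k ∷ β
    covers′ {x} lo≤x x<1+k with m<1+n⇒m<n∨m≡n x<1+k | s ≤? x
    ... | inj₂ refl | _       = ∈-++⁺ʳ α (here refl)
    ... | inj₁ x<k  | yes s≤x = ∈-++⁺ˡ (covers A s≤x x<k)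
    ... | inj₁ x<k  | no  s≰x = ∈-++⁺ʳ α (there (covers B lo≤x (≰⇒> s≰x)))

  module _ {lo k : ℕ} (α : List ℕ) {β : List ℕ} (A : Arranges lo (suc k) (α ++ k ∷ β)) where

    private
      parts : Unique α × Unique (k ∷ β) × Disjoint α (k ∷ β)
      parts = Unique-++⁻ α (unique A)

    upper-unique : Unique α
    upper-unique = proj₁ parts

    upper<max : a ∈ α → a < k
    upper<max p = ≤∧≢⇒< (s≤s⁻¹ (proj₂ (bounds A (∈-++⁺ˡ p)))) λ a≡k → proj₂ (proj₂ parts) (p , here a≡k)

    lower-unique : Unique β
    lower-unique with _ ∷ u ← proj₁ (proj₂ parts) = u

    lower<max : b ∈ β → b < k
    lower<max q with proj₁ (proj₂ parts)
    ... | k∉β ∷ _ = ≤∧≢⇒< (s≤s⁻¹ (proj₂ (bounds A (∈-++⁺ʳ α (there q)))))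
                          λ b≡k → All¬⇒¬Any k∉β (subst (_∈ β) b≡k q)

    locate : lo ≤ x → x < suc k → x ∈ α ⊎ x ≡ k ⊎ x ∈ β
    locate lo≤x x<1+k with ∈-++⁻ α (covers A lo≤x x<1+k)
    ... | inj₁ p         = inj₁ p
    ... | inj₂ (here eq) = inj₂ (inj₁ eq)
    ... | inj₂ (there q) = inj₂ (inj₂ q)

    lower<upper : a ∈ α → b ∈ β → b < a
    lower<upper {a} {b} p q with <-cmp a b
    ... | tri< a<b _ _ = contradiction (lower<max q) (avoids A (Occurs₃-++-∷ α p q) a<b)
    ... | tri≈ _ refl _ = contradiction (p , there q) (proj₂ (proj₂ parts))
    ... | tri> _ _ b<a = b<a

  Arranges-++-∷⁻ : s ≤ k → All (s ≤_) α → All (_< s) β → Arranges 0 (suc k) (α ++ k ∷ β) →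
                   Arranges s k α × Arranges 0 s β
  Arranges-++-∷⁻ {s} {k} {α} {β} s≤k α≥s β<s A = upper , lower
    where
    upper : Arranges s k α
    upper = record
      { unique = upper-unique α A
      ; bounds = λ p → All.lookup α≥s p , upper<max α A p
      ; covers = λ s≤x x<k → only-upper s≤x (locate α A z≤n (m≤n⇒m≤1+n x<k)) x<k
      ; avoids = avoids A ∘ Occurs₃-++⁺ˡ (k ∷ β)
      }
      where
      only-upper : s ≤ x → x ∈ α ⊎ x ≡ k ⊎ x ∈ β → x < k → x ∈ α
      only-upper s≤x (inj₁ p)           x<k = p
      only-upper s≤x (inj₂ (inj₁ refl)) x<k = contradiction x<k (<-irrefl refl)
      only-upper s≤x (inj₂ (inj₂ q))    x<k = contradiction (All.lookup β<s q) (≤⇒≯ s≤x)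
    lower : Arranges 0 s β
    lower = record
      { unique = lower-unique α A
      ; bounds = λ q → z≤n , All.lookup β<s q
      ; covers = λ _ x<s → only-lower (locate α A z≤n (m≤n⇒m≤1+n (<-≤-trans x<s s≤k))) x<s
      ; avoids = avoids A ∘ Occurs₃-++⁺ʳ α ∘ there₃
      }
      where
      only-lower : x ∈ α ⊎ x ≡ k ⊎ x ∈ β → x < s → x ∈ β
      only-lower (inj₁ p)           x<s = contradiction (All.lookup α≥s p) (<⇒≱ x<s)
      only-lower (inj₂ (inj₁ refl)) x<s = contradiction s≤k (<⇒≱ x<s)
      only-lower (inj₂ (inj₂ q))    x<s = q

  Arranges-[_] : ∀ x → Arranges x (suc x) (x ∷ [])
  Arranges-[ x ] = Arranges-++-∷⁺ ≤-refl ≤-refl Arranges-[] Arranges-[]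

  record Framed (k : ℕ) (h l : Window) (σ : List ℕ) : Set where
    field
      arranges : Arranges 0 k σ
      linked   : Linked (Near 3) σ
      starts   : First (InWindow h k) σ
      ends     : Last (InWindow l k) σ
  open Framed

  Framed⇒Last< : Framed k h l σ → Last (_< k) σ
  Framed⇒Last< {σ = σ} F = Last-mapWith∈ σ (λ p _ → proj₂ (bounds (arranges F) p)) (ends F)

  Family : Set₁
  Family = ℕ → Window → Window → List ℕ → Set

  -- Where the maximum k of a 132-avoiding permutation of [0, k] with adjacent differences ≤ 3
  -- sits.  The entries before k exceed those after it, and the entry right after k is at least
  -- k ∸ 3; so unless k comes last, the entries before it are none, [k ∸ 1], [k ∸ 1, k ∸ 2] or
  -- [k ∸ 2, k ∸ 1].  The windows of the pieces are what the adjacency at k and the windows of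
  -- the whole permutation require.
  data Shape (P : Family) : Family where
    single   : Reaches h 1 → Reaches l 1 → Shape P 0 h l (0 ∷ [])
    maxFirst : Reaches h 1 → P k (top 3) (shrink 1 l) β → Shape P k h l (k ∷ β)
    maxLast  : Reaches l 1 → P k (shrink 1 h) (top 3) α → Shape P k h l (α ∷ʳ k)
    rise     : Reaches h 2 → P (suc j) (top 2) (shrink 2 l) β → Shape P (2 + j) h l (suc j ∷ 2 + j ∷ β)
    fallRise : Reaches h 2 → P j (top 1) (shrink 3 l) β → Shape P (2 + j) h l (suc j ∷ j ∷ 2 + j ∷ β)
    riseRise : Reaches h 3 → P j (top 1) (shrink 3 l) β → Shape P (2 + j) h l (j ∷ suc j ∷ 2 + j ∷ β)

  Shape-map : ∀ {P Q : Family} → (∀ {s h l σ} → s ≤ k → P s h l σ → Q s h l σ) →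
              Shape P k h l σ → Shape Q k h l σ
  Shape-map f (single rh rl) = single rh rl
  Shape-map f (maxFirst r p) = maxFirst r (f ≤-refl p)
  Shape-map f (maxLast r p)  = maxLast r (f ≤-refl p)
  Shape-map f (rise r p)     = rise r (f (n≤1+n _) p)
  Shape-map f (fallRise r p) = fallRise r (f (m≤n+m _ 2) p)
  Shape-map f (riseRise r p) = riseRise r (f (m≤n+m _ 2) p)

  extend-below : ∀ π {c d} → s ≤ k → Arranges s k π → Linked (Near 3) (π ∷ʳ k) →
                 (∀ {xs} → First (InWindow h (suc k)) (π ++ k ∷ xs)) →
                 (∀ {b} → s ≤ c + b → k ≤ 3 + b) → d + s ≡ suc k →
                 Framed s (top c) (shrink d l) β → Framed (suc k) h l (π ++ k ∷ β)
  extend-below {β = []} π _ _ _ _ _ _ F = ⊥-elim (starts F)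
  extend-below {s} {l = l} {b ∷ β} π {d = d} s≤k A linked-π start max≤ d+s≡1+k F = record
    { arranges = Arranges-++-∷⁺ z≤n s≤k A (arranges F)
    ; linked   = Linked-∷ʳ-++ π linked-π
                   (Near-down (<-≤-trans (below (here refl)) s≤k) (max≤ (starts F)) ∷ linked F)
    ; starts   = start
    ; ends     = Last-++⁺ π (subst (λ n → Last (InWindow l n) (b ∷ β)) d+s≡1+k
                   (Last-mapWith∈ (b ∷ β) (λ p → InWindow-shrink⁺ l d (below p)) (ends F)))
    }
    where
    below : ∀ {x} → x ∈ b ∷ β → x < s
    below p = proj₂ (bounds (arranges F) p)

  extend-above : Reaches l 1 → Framed k (shrink 1 h) (top 3) α → Framed (suc k) h l (α ∷ʳ k)
  extend-above {α = []} _ F = ⊥-elim (starts F)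
  extend-above {l} {k} {h} {a ∷ α} rl F = record
    { arranges = Arranges-++-∷⁺ z≤n z≤n (arranges F) Arranges-[]
    ; linked   = Linked-∷ʳ⁺ (a ∷ α) (linked F)
                   (Last-mapWith∈ (a ∷ α) (λ p → ≤⇒Near (<⇒≤ (below p))) (ends F))
    ; starts   = InWindow-shrink⁺ h 1 (below (here refl)) (starts F)
    ; ends     = Last-++⁺ (a ∷ α) (Reaches⇒InWindow l k rl)
    }
    where
    below : ∀ {x} → x ∈ a ∷ α → x < k
    below p = proj₂ (bounds (arranges F) p)

  compose : Shape Framed k h l σ → Framed (suc k) h l σ
  compose (single {h = h} {l = l} rh rl) = record
    { arranges = Arranges-++-∷⁺ z≤n z≤n Arranges-[] Arranges-[]
    ; linked   = [-]
    ; starts   = Reaches⇒InWindow h 0 rh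
    ; ends     = Reaches⇒InWindow l 0 rl
    }
  compose (maxFirst {h = h} {k = k} rh F) =
    extend-below [] ≤-refl Arranges-[] [-] (Reaches⇒InWindow h k rh) id refl F
  compose (maxLast rl F) = extend-above rl F
  compose (rise {h = h} {j = j} rh F) =
    extend-below [ suc j ] (n≤1+n _) Arranges-[ suc j ] (Near-+ 1 (suc j) (s≤s z≤n) ∷ [-])
                 (Reaches⇒InWindow h (suc j) rh) s≤s refl F
  compose (fallRise {h = h} {j = j} rh F) =
    extend-below (suc j ∷ j ∷ []) (m≤n+m j 2) (Arranges-++-∷⁺ (n≤1+n j) ≤-refl Arranges-[] Arranges-[ j ])
                 (Near-sym (Near-+ 1 j (s≤s z≤n)) ∷ Near-+ 2 j (s≤s (s≤s z≤n)) ∷ [-])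
                 (Reaches⇒InWindow h (suc j) rh) (s≤s ∘ s≤s) refl F
  compose (riseRise {h = h} {j = j} rh F) =
    extend-below (j ∷ suc j ∷ []) (m≤n+m j 2) (Arranges-++-∷⁺ ≤-refl (n≤1+n j) Arranges-[ j ] Arranges-[])
                 (Near-+ 1 j (s≤s z≤n) ∷ Near-+ 1 (suc j) (s≤s z≤n) ∷ [-])
                 (Reaches⇒InWindow h j rh) (s≤s ∘ s≤s) refl F

  restrict-below : ∀ α {c} d → s ≤ k → All (s ≤_) α → All (_< s) (b ∷ β) → s ≤ c + b →
                   d + s ≡ suc k → Framed (suc k) h l (α ++ k ∷ b ∷ β) → Framed s (top c) (shrink d l) (b ∷ β)
  restrict-below {b = b} {β = β} {l = l} α d s≤k α≥s β<s start d+s≡1+k F = record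
    { arranges = proj₂ (Arranges-++-∷⁻ s≤k α≥s β<s (arranges F))
    ; linked   = Linked.tail (Linked-++⁻ʳ α (linked F))
    ; starts   = start
    ; ends     = Last-mapWith∈ (b ∷ β)
                   (λ {x} _ → InWindow-shrink⁻ l d ∘ subst (λ n → InWindow l n x) (sym d+s≡1+k))
                   (Last-++⁻ α (ends F))
    }

  restrict-above : Framed (suc k) h l ((a ∷ α) ∷ʳ k) → Framed k (shrink 1 h) (top 3) (a ∷ α)
  restrict-above {h = h} {a = a} {α = α} F = record
    { arranges = proj₁ (Arranges-++-∷⁻ z≤n (All.tabulate λ _ → z≤n) [] (arranges F))
    ; linked   = proj₁ (Linked-∷ʳ⁻ a α (linked F))
    ; starts   = InWindow-shrink⁻ h 1 (starts F)
    ; ends     = Last-mapWith∈ (a ∷ α) (λ _ → Near⇒≤) (proj₂ (Linked-∷ʳ⁻ a α (linked F)))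
    }

  max≤3+ : ∀ α → Framed (suc k) h l (α ++ k ∷ b ∷ β) → k ≤ 3 + b
  max≤3+ α F = Near⇒≤ (Near-sym (Linked.head (Linked-++⁻ʳ α (linked F))))

  <-<⇒2+ : a < x → x < k → ∃[ j ] k ≡ 2 + j
  <-<⇒2+ {x = suc x} (s≤s _) (s≤s (s≤s _)) = _ , refl

  between : b < x → x < k → k ≤ 3 + b → x ≡ suc b ⊎ x ≡ 2 + b
  between b<x x<k k≤3+b with m<1+n⇒m<n∨m≡n (<-≤-trans x<k k≤3+b)
  ... | inj₁ x<2+b = inj₁ (≤-antisym (s≤s⁻¹ x<2+b) b<x)
  ... | inj₂ x≡2+b = inj₂ x≡2+b

  pigeonhole : ∀ {u v x y z : ℕ} → x ≡ u ⊎ x ≡ v → y ≡ u ⊎ y ≡ v → z ≡ u ⊎ z ≡ v →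
               x ≢ y → x ≢ z → y ≢ z → ⊥
  pigeonhole (inj₁ refl) (inj₁ refl) _           x≢y _   _   = x≢y refl
  pigeonhole (inj₂ refl) (inj₂ refl) _           x≢y _   _   = x≢y refl
  pigeonhole (inj₁ refl) (inj₂ refl) (inj₁ refl) _   x≢z _   = x≢z refl
  pigeonhole (inj₁ refl) (inj₂ refl) (inj₂ refl) _   _   y≢z = y≢z refl
  pigeonhole (inj₂ refl) (inj₁ refl) (inj₁ refl) _   _   y≢z = y≢z refl
  pigeonhole (inj₂ refl) (inj₁ refl) (inj₂ refl) _   x≢z _   = x≢z refl

  just-above : ∀ α → Framed (suc k) h l (α ++ k ∷ b ∷ β) → x ∈ α → x ≡ suc b ⊎ x ≡ 2 + b
  just-above α F p = between (lower<upper α (arranges F) p (here refl)) (upper<max α (arranges F) p) (max≤3+ α F)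

  decompose-middle : ∀ a α → Framed (suc k) h l (a ∷ α ++ k ∷ b ∷ β) →
                     Shape Framed k h l (a ∷ α ++ k ∷ b ∷ β)
  decompose-middle {h = h} a [] F
    with <-<⇒2+ (lower<upper [ a ] (arranges F) (here refl) (here refl)) (upper<max [ a ] (arranges F) (here refl))
  ... | j , refl with locate [ a ] (arranges F) z≤n (m≤n⇒m≤1+n (n<1+n (suc j)))
  ...   | inj₁ (here refl) =
          rise (InWindow⇒Reaches h (suc j) (starts F))
               (restrict-below [ a ] 2 (n≤1+n _) (≤-refl ∷ [])
                               (All.tabulate (lower<upper [ a ] (arranges F) (here refl)))
                               (s≤s⁻¹ (max≤3+ [ a ] F)) refl F)
  ...   | inj₂ (inj₂ q) =
          contradiction (lower<upper [ a ] (arranges F) (here refl) q)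
                        (≤⇒≯ (s≤s⁻¹ (upper<max [ a ] (arranges F) (here refl))))
  decompose-middle {h = h} {b = b} x (y ∷ []) F
    with just-above (x ∷ y ∷ []) F (here refl) | just-above (x ∷ y ∷ []) F (there (here refl))
       | upper-unique (x ∷ y ∷ []) (arranges F)
  ... | inj₁ refl | inj₁ refl | (x≢y ∷ []) ∷ _ = contradiction refl x≢y
  ... | inj₂ refl | inj₂ refl | (x≢y ∷ []) ∷ _ = contradiction refl x≢y
  ... | inj₂ refl | inj₁ refl | _
    with refl ← ≤-antisym (max≤3+ (x ∷ y ∷ []) F) (upper<max (x ∷ y ∷ []) (arranges F) (here refl)) =
    fallRise (InWindow⇒Reaches h (2 + b) (starts F))
             (restrict-below (x ∷ y ∷ []) 3 (m≤n+m _ 2) (n≤1+n _ ∷ ≤-refl ∷ [])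
                             (All.tabulate (lower<upper (x ∷ y ∷ []) (arranges F) (there (here refl)))) ≤-refl refl F)
  ... | inj₁ refl | inj₂ refl | _
    with refl ← ≤-antisym (max≤3+ (x ∷ y ∷ []) F) (upper<max (x ∷ y ∷ []) (arranges F) (there (here refl))) =
    riseRise (InWindow⇒Reaches h (suc b) (starts F))
             (restrict-below (x ∷ y ∷ []) 3 (m≤n+m _ 2) (≤-refl ∷ n≤1+n _ ∷ [])
                             (All.tabulate (lower<upper (x ∷ y ∷ []) (arranges F) (here refl))) ≤-refl refl F)
  decompose-middle {b = b} x (y ∷ z ∷ α) F with upper-unique (x ∷ y ∷ z ∷ α) (arranges F)
  ... | (x≢y ∷ x≢z ∷ _) ∷ (y≢z ∷ _) ∷ _ =
    ⊥-elim (pigeonhole (above (here refl)) (above (there (here refl))) (above (there (there (here refl))))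
                       x≢y x≢z y≢z)
    where
    above : ∀ {w} → w ∈ x ∷ y ∷ z ∷ α → w ≡ suc b ⊎ w ≡ 2 + b
    above = just-above (x ∷ y ∷ z ∷ α) F

  decompose-at : ∀ α β → Framed (suc k) h l (α ++ k ∷ β) → Shape Framed k h l (α ++ k ∷ β)
  decompose-at {zero} {h} {l} [] [] F = single (InWindow⇒Reaches h 0 (starts F)) (InWindow⇒Reaches l 0 (ends F))
  decompose-at {suc k} [] [] F with covers (arranges F) z≤n z<s
  ... | here ()
  ... | there ()
  decompose-at {k} {h} [] (b ∷ β) F =
    maxFirst (InWindow⇒Reaches h k (starts F))
             (restrict-below [] 1 ≤-refl [] (All.tabulate (lower<max [] (arranges F))) (max≤3+ [] F) refl F)
  decompose-at {k} {h} {l} (a ∷ α) [] F =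
    maxLast (InWindow⇒Reaches l k (Last-++⁻ (a ∷ α) (ends F))) (restrict-above F)
  decompose-at (a ∷ α) (b ∷ β) F = decompose-middle a α F

  decompose : Framed (suc k) h l σ → Shape Framed k h l σ
  decompose {k} F with ∈-∃++ (covers (arranges F) z≤n (n<1+n k))
  ... | α , β , refl = decompose-at α β F

  prefixed : List ℕ → Window → ℕ → List (List ℕ) → List (List ℕ)
  prefixed π w i xss = ifReaches w i (map (π ++_) xss)

  ∈-prefixed⁻ : ∀ π w i {xss} → σ ∈ prefixed π w i xss → Reaches w i × ∃[ β ] β ∈ xss × σ ≡ π ++ β
  ∈-prefixed⁻ π w i p with ∈-ifReaches⁻ w i p
  ... | r , q with ∈-map⁻ (π ++_) q
  ...   | β , β∈ , refl = r , β , β∈ , refl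

  ∈-prefixed⁺ : ∀ π w {i xss} → Reaches w i → β ∈ xss → π ++ β ∈ prefixed π w i xss
  ∈-prefixed⁺ π w r p = ∈-ifReaches⁺ w r (∈-map⁺ (π ++_) p)

  prefixed⁺ : ∀ π w i {xss} → Unique xss → Unique (prefixed π w i xss)
  prefixed⁺ π w i u = ifReaches⁺ w i (Unique.map⁺ (++-cancelˡ π _ _) u)

  framed    : ℕ → Window → Window → List (List ℕ)
  maxFirsts : ℕ → Window → Window → List (List ℕ)
  middles   : ℕ → Window → Window → List (List ℕ)
  maxLasts  : ℕ → Window → Window → List (List ℕ)
  rises     : ℕ → Window → Window → List (List ℕ)
  fallRises : ℕ → Window → Window → List (List ℕ)
  riseRises : ℕ → Window → Window → List (List ℕ)

  framed zero          h l = []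
  framed (suc zero)    h l = ifReaches h 1 (ifReaches l 1 ((0 ∷ []) ∷ []))
  framed (suc (suc k)) h l = maxFirsts (suc k) h l ++ middles (suc k) h l ++ maxLasts (suc k) h l

  maxFirsts k h l = prefixed (k ∷ []) h 1 (framed k (top 3) (shrink 1 l))
  maxLasts  k h l = ifReaches l 1 (map (_∷ʳ k) (framed k (shrink 1 h) (top 3)))

  middles k h l = rises k h l ++ fallRises k h l ++ riseRises k h l

  rises zero          h l = []
  rises (suc zero)    h l = []
  rises (suc (suc j)) h l = prefixed (suc j ∷ 2 + j ∷ []) h 2 (framed (suc j) (top 2) (shrink 2 l))

  fallRises zero          h l = []
  fallRises (suc zero)    h l = []
  fallRises (suc (suc j)) h l = prefixed (suc j ∷ j ∷ 2 + j ∷ []) h 2 (framed j (top 1) (shrink 3 l))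

  riseRises zero          h l = []
  riseRises (suc zero)    h l = []
  riseRises (suc (suc j)) h l = prefixed (j ∷ suc j ∷ 2 + j ∷ []) h 3 (framed j (top 1) (shrink 3 l))

  InFramed : Family
  InFramed k h l σ = σ ∈ framed k h l

  ∈-middles⁻ : ∀ k → σ ∈ middles k h l → Shape InFramed k h l σ
  ∈-middles⁻ zero          ()
  ∈-middles⁻ (suc zero)    ()
  ∈-middles⁻ {h = h} {l = l} (suc (suc j)) p with ∈-++⁻ (rises (2 + j) h l) p
  ... | inj₁ q with ∈-prefixed⁻ _ h 2 q
  ...   | r , β , β∈ , refl = rise r β∈
  ∈-middles⁻ {h = h} {l = l} (suc (suc j)) p | inj₂ q with ∈-++⁻ (fallRises (2 + j) h l) q
  ... | inj₁ q′ with ∈-prefixed⁻ _ h 2 q′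
  ...   | r , β , β∈ , refl = fallRise r β∈
  ∈-middles⁻ {h = h} {l = l} (suc (suc j)) p | inj₂ q | inj₂ q′ with ∈-prefixed⁻ _ h 3 q′
  ... | r , β , β∈ , refl = riseRise r β∈

  ∈-framed⁻ : ∀ k → σ ∈ framed (suc k) h l → Shape InFramed k h l σ
  ∈-framed⁻ {h = h} {l = l} zero p with ∈-ifReaches⁻ h 1 p
  ... | rh , q with ∈-ifReaches⁻ l 1 q
  ...   | rl , here refl = single rh rl
  ∈-framed⁻ {h = h} {l = l} (suc k) p with ∈-++⁻ (maxFirsts (suc k) h l) p
  ... | inj₁ q with ∈-prefixed⁻ _ h 1 q
  ...   | r , β , β∈ , refl = maxFirst r β∈
  ∈-framed⁻ {h = h} {l = l} (suc k) p | inj₂ q with ∈-++⁻ (middles (suc k) h l) q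
  ... | inj₁ q′ = ∈-middles⁻ (suc k) q′
  ... | inj₂ q′ with ∈-ifReaches⁻ l 1 q′
  ...   | r , q″ with ∈-map⁻ (_∷ʳ suc k) q″
  ...     | α , α∈ , refl = maxLast r α∈

  ∈-framed⁺ : Shape InFramed k h l σ → σ ∈ framed (suc k) h l
  ∈-framed⁺ (single {h = h} {l = l} rh rl) = ∈-ifReaches⁺ h rh (∈-ifReaches⁺ l rl (here refl))
  ∈-framed⁺ (maxFirst {h = h} {k = suc k} r p) = ∈-++⁺ˡ (∈-prefixed⁺ (suc k ∷ []) h r p)
  ∈-framed⁺ (maxLast {l = l} {k = suc k} {h = h} r p) =
    ∈-++⁺ʳ (maxFirsts (suc k) h l) (∈-++⁺ʳ (middles (suc k) h l) (∈-ifReaches⁺ l r (∈-map⁺ (_∷ʳ suc k) p)))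
  ∈-framed⁺ (rise {h = h} {j = j} {l = l} r p) =
    ∈-++⁺ʳ (maxFirsts (2 + j) h l) (∈-++⁺ˡ (∈-++⁺ˡ (∈-prefixed⁺ (suc j ∷ 2 + j ∷ []) h r p)))
  ∈-framed⁺ (fallRise {h = h} {j = j} {l = l} r p) =
    ∈-++⁺ʳ (maxFirsts (2 + j) h l) (∈-++⁺ˡ (∈-++⁺ʳ (rises (2 + j) h l)
      (∈-++⁺ˡ (∈-prefixed⁺ (suc j ∷ j ∷ 2 + j ∷ []) h r p))))
  ∈-framed⁺ (riseRise {h = h} {j = j} {l = l} r p) =
    ∈-++⁺ʳ (maxFirsts (2 + j) h l) (∈-++⁺ˡ (∈-++⁺ʳ (rises (2 + j) h l)
      (∈-++⁺ʳ (fallRises (2 + j) h l) (∈-prefixed⁺ (j ∷ suc j ∷ 2 + j ∷ []) h r p))))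

  framed-sound : ∀ k {h l σ} → σ ∈ framed k h l → Framed k h l σ
  framed-sound = <-rec (λ k → ∀ {h l σ} → σ ∈ framed k h l → Framed k h l σ) λ where
    zero    _   ()
    (suc k) rec p → compose (Shape-map (λ s≤k → rec (s≤s s≤k)) (∈-framed⁻ k p))

  ¬Framed-0 : ¬ Framed 0 h l σ
  ¬Framed-0 {σ = []}    F = starts F
  ¬Framed-0 {σ = x ∷ _} F = contradiction (proj₂ (bounds (arranges F) (here refl))) λ ()

  framed-complete : ∀ k {h l σ} → Framed k h l σ → σ ∈ framed k h l
  framed-complete = <-rec (λ k → ∀ {h l σ} → Framed k h l σ → σ ∈ framed k h l) λ where
    zero    _   F → ⊥-elim (¬Framed-0 F)
    (suc k) rec F → ∈-framed⁺ (Shape-map (λ s≤k → rec (s≤s s≤k)) (decompose F))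

  Disjoint-++⁺ʳ : ∀ yss → Disjoint xss yss → Disjoint xss zss → Disjoint xss (yss ++ zss)
  Disjoint-++⁺ʳ yss d₁ d₂ (p , q) with ∈-++⁻ yss q
  ... | inj₁ q′ = d₁ (p , q′)
  ... | inj₂ q′ = d₂ (p , q′)

  prefixed-disjoint : ∀ π w i π′ w′ i′ → (∀ {β β′} → π ++ β ≢ π′ ++ β′) →
                      Disjoint (prefixed π w i xss) (prefixed π′ w′ i′ yss)
  prefixed-disjoint π w i π′ w′ i′ π≢π′ (p , q) with ∈-prefixed⁻ π w i p | ∈-prefixed⁻ π′ w′ i′ q
  ... | _ , β , _ , refl | _ , β′ , _ , eq = π≢π′ eq

  prefixed-Last< : ∀ π w i s {h l} → s ≤ m → σ ∈ prefixed π w i (framed s h l) → Last (_< m) σ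
  prefixed-Last< π w i s s≤m p with ∈-prefixed⁻ π w i p
  ... | _ , [] , β∈ , refl = ⊥-elim (starts (framed-sound s β∈))
  ... | _ , b ∷ β , β∈ , refl =
    Last-++⁺ π (Last-mapWith∈ (b ∷ β) (λ _ x<s → <-≤-trans x<s s≤m) (Framed⇒Last< (framed-sound s β∈)))

  maxLasts-disjoint : ∀ k h l → (∀ {σ} → σ ∈ xss → Last (_< k) σ) → Disjoint xss (maxLasts k h l)
  maxLasts-disjoint k h l below (p , q) with ∈-map⁻ (_∷ʳ k) (proj₂ (∈-ifReaches⁻ l 1 q))
  ... | α , _ , refl = <-irrefl refl (Last-++⁻ α (below p))

  middles-Last< : ∀ k → σ ∈ middles (suc k) h l → Last (_< suc k) σ
  middles-Last< {h = h} {l = l} (suc j) p with ∈-++⁻ (rises (2 + j) h l) p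
  ... | inj₁ q = prefixed-Last< _ h 2 (suc j) (n≤1+n _) q
  ... | inj₂ q with ∈-++⁻ (fallRises (2 + j) h l) q
  ...   | inj₁ q′ = prefixed-Last< _ h 2 j (m≤n+m j 2) q′
  ...   | inj₂ q′ = prefixed-Last< _ h 3 j (m≤n+m j 2) q′

  maxFirsts-middles-disjoint : ∀ k → Disjoint (maxFirsts (suc k) h l) (middles (suc k) h l)
  maxFirsts-middles-disjoint zero (_ , ())
  maxFirsts-middles-disjoint {h = h} {l = l} (suc j) =
    Disjoint-++⁺ʳ (rises (2 + j) h l) (prefixed-disjoint (2 + j ∷ []) h 1 (suc j ∷ 2 + j ∷ []) h 2 λ ())
      (Disjoint-++⁺ʳ (fallRises (2 + j) h l) (prefixed-disjoint (2 + j ∷ []) h 1 (suc j ∷ j ∷ 2 + j ∷ []) h 2 λ ())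
                                       (prefixed-disjoint (2 + j ∷ []) h 1 (j ∷ suc j ∷ 2 + j ∷ []) h 3 λ ()))

  framed-unique  : ∀ k h l → Unique (framed k h l)
  middles-unique : ∀ k h l → Unique (middles k h l)

  framed-unique zero          h l = []
  framed-unique (suc zero)    h l = ifReaches⁺ h 1 (ifReaches⁺ l 1 ([] ∷ []))
  framed-unique (suc (suc k)) h l =
    Unique.++⁺ (prefixed⁺ _ h 1 (framed-unique (suc k) _ _))
      (Unique.++⁺ (middles-unique (suc k) h l)
                  (ifReaches⁺ l 1 (Unique.map⁺ (∷ʳ-injectiveˡ _ _) (framed-unique (suc k) _ _)))
                  (maxLasts-disjoint (suc k) h l (middles-Last< k)))
      (Disjoint-++⁺ʳ (middles (suc k) h l) (maxFirsts-middles-disjoint k)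
        (maxLasts-disjoint (suc k) h l (prefixed-Last< (suc k ∷ []) h 1 (suc k) ≤-refl)))

  middles-unique zero          h l = []
  middles-unique (suc zero)    h l = []
  middles-unique (suc (suc j)) h l =
    Unique.++⁺ (prefixed⁺ _ h 2 (framed-unique (suc j) _ _))
      (Unique.++⁺ (prefixed⁺ _ h 2 (framed-unique j _ _)) (prefixed⁺ _ h 3 (framed-unique j _ _))
        (prefixed-disjoint (suc j ∷ j ∷ 2 + j ∷ []) h 2 (j ∷ suc j ∷ 2 + j ∷ []) h 3 λ ()))
      (Disjoint-++⁺ʳ (fallRises (2 + j) h l)
        (prefixed-disjoint (suc j ∷ 2 + j ∷ []) h 2 (suc j ∷ j ∷ 2 + j ∷ []) h 2 λ ())
        (prefixed-disjoint (suc j ∷ 2 + j ∷ []) h 2 (j ∷ suc j ∷ 2 + j ∷ []) h 3 λ ()))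

  Occurs₂⇒indices : Occurs₂ b c σ → ∃[ j ] ∃[ k ] toℕ j < toℕ k × lookup σ j ≡ b × lookup σ k ≡ c
  Occurs₂⇒indices (here₂ p)  = zero , suc (index p) , s≤s z≤n , refl , sym (lookup-index p)
  Occurs₂⇒indices (there₂ o) with j , k , j<k , refl , refl ← Occurs₂⇒indices o =
    suc j , suc k , s≤s j<k , refl , refl

  Occurs₃⇒indices : Occurs₃ a b c σ →
    ∃[ i ] ∃[ j ] ∃[ k ] toℕ i < toℕ j × toℕ j < toℕ k × lookup σ i ≡ a × lookup σ j ≡ b × lookup σ k ≡ c
  Occurs₃⇒indices (here₃ o) with j , k , j<k , refl , refl ← Occurs₂⇒indices o =
    zero , suc j , suc k , s≤s z≤n , s≤s j<k , refl , refl , refl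
  Occurs₃⇒indices (there₃ o) with i , j , k , i<j , j<k , refl , refl , refl ← Occurs₃⇒indices o =
    suc i , suc j , suc k , s≤s i<j , s≤s j<k , refl , refl , refl

  indices⇒Occurs₂ : ∀ σ (j k : Fin (length σ)) → toℕ j < toℕ k → Occurs₂ (lookup σ j) (lookup σ k) σ
  indices⇒Occurs₂ (x ∷ σ) zero    (suc k) _         = here₂ (∈-lookup k)
  indices⇒Occurs₂ (x ∷ σ) (suc j) (suc k) (s≤s j<k) = there₂ (indices⇒Occurs₂ σ j k j<k)

  indices⇒Occurs₃ : ∀ σ (i j k : Fin (length σ)) → toℕ i < toℕ j → toℕ j < toℕ k →
                    Occurs₃ (lookup σ i) (lookup σ j) (lookup σ k) σ
  indices⇒Occurs₃ (x ∷ σ) zero    (suc j) (suc k) _         (s≤s j<k) =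
    here₃ (indices⇒Occurs₂ σ j k j<k)
  indices⇒Occurs₃ (x ∷ σ) (suc i) (suc j) (suc k) (s≤s i<j) (s≤s j<k) =
    there₃ (indices⇒Occurs₃ σ i j k i<j j<k)

  Avoids132⇔Avoids132′ : Avoids132 σ ⇔ Avoids132′ σ
  Avoids132⇔Avoids132′ {σ} = mk⇔
    (λ av {a} {b} {c} o a<c c<b → let i , j , k , i<j , j<k , eᵢ , eⱼ , eₖ = Occurs₃⇒indices o in
                      av i j k i<j j<k (subst₂ _<_ (sym eᵢ) (sym eₖ) a<c , subst₂ _<_ (sym eₖ) (sym eⱼ) c<b))
    (λ av i j k i<j j<k (a<c , c<b) → av (indices⇒Occurs₃ σ i j k i<j j<k) a<c c<b)

  AdjBounded⇔Linked : AdjBounded m σ ⇔ Linked (Near m) σ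
  AdjBounded⇔Linked = mk⇔ (to _) (from _)
    where
    to : ∀ σ → AdjBounded m σ → Linked (Near m) σ
    to []          adj = []
    to (x ∷ [])    adj = [-]
    to (x ∷ y ∷ σ) adj = near (adj zero (suc zero) refl) ∷ to (y ∷ σ) λ i j eq → adj (suc i) (suc j) (cong suc eq)
    from : ∀ σ → Linked (Near m) σ → AdjBounded m σ
    from (x ∷ y ∷ σ) (near d ∷ l) zero    (suc zero)    eq = d
    from (x ∷ y ∷ σ) (near d ∷ l) (suc i) (suc j)       eq = from (y ∷ σ) l i j (suc-injective eq)
    from (x ∷ [])    [-]          zero    zero          ()
    from (x ∷ y ∷ σ) l            zero    zero          ()
    from (x ∷ y ∷ σ) l            zero    (suc (suc j)) ()
    from (x ∷ y ∷ σ) l            (suc i) zero          ()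

  IsPerm⇔unique-range : IsPerm k σ ⇔ (Unique σ × (∀ {x} → x ∈ σ ⇔ x < k))
  IsPerm⇔unique-range {k} {σ} = mk⇔
    (λ σ↭ → Permutationₛ.Unique-resp-↭ (setoid ℕ) (↭⇒↭ₛ (↭-sym σ↭)) (Unique.upTo⁺ k)
          , λ {x} → mk⇔ (∈-upTo⁻ ∘ ∈-resp-↭ σ↭) (∈-resp-↭ (↭-sym σ↭) ∘ ∈-upTo⁺))
    (λ (u , ∈⇔<) → ∼bag⇒↭ (unique∧set⇒bag {xs = σ} u (Unique.upTo⁺ k)
                     (λ {x} → mk⇔ (∈-upTo⁺ ∘ Equivalence.to (∈⇔< {x})) (Equivalence.from (∈⇔< {x}) ∘ ∈-upTo⁻))))

  Framed⇒Valid : Framed k h l σ → Valid 3 k σ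
  Framed⇒Valid F =
    Equivalence.from IsPerm⇔unique-range
      (unique (arranges F) , mk⇔ (proj₂ ∘ bounds (arranges F)) (covers (arranges F) z≤n)) ,
    Equivalence.from Avoids132⇔Avoids132′ (avoids (arranges F)) ,
    Equivalence.from AdjBounded⇔Linked (linked F)

  Valid⇒Framed : ∀ k → Valid 3 (suc k) σ → Framed (suc k) whole whole σ
  Valid⇒Framed {[]} k (perm , _)
    with () ← Equivalence.from (proj₂ (Equivalence.to IsPerm⇔unique-range perm)) (z<s {k})
  Valid⇒Framed {x ∷ σ} k (perm , av , adj) = record
    { arranges = record
      { unique = proj₁ arranged
      ; bounds = λ p → z≤n , Equivalence.to (proj₂ arranged) p
      ; covers = λ _ → Equivalence.from (proj₂ arranged)
      ; avoids = Equivalence.to Avoids132⇔Avoids132′ av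
      }
    ; linked   = Equivalence.to AdjBounded⇔Linked adj
    ; starts   = tt
    ; ends     = Last-const tt x σ
    }
    where
    arranged : Unique (x ∷ σ) × (∀ {y} → y ∈ x ∷ σ ⇔ y < suc k)
    arranged = Equivalence.to IsPerm⇔unique-range perm

  validPerms : ℕ → List (List ℕ)
  validPerms zero    = [] ∷ []
  validPerms (suc k) = framed (suc k) whole whole

  validPerms-unique : ∀ k → Unique (validPerms k)
  validPerms-unique zero    = [] ∷ []
  validPerms-unique (suc k) = framed-unique (suc k) whole whole

  ∈-validPerms : ∀ k → σ ∈ validPerms k ⇔ Valid 3 k σ
  ∈-validPerms zero    = mk⇔ (λ { (here refl) → ↭-refl , (λ ()) , (λ ()) })
                             (λ (σ↭[] , _) → here (↭-empty-inv σ↭[]))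
  ∈-validPerms (suc k) = mk⇔ (Framed⇒Valid ∘ framed-sound (suc k)) (framed-complete (suc k) ∘ Valid⇒Framed k)

  count : ℕ → Window → Window → ℕ
  count k h l = length (framed k h l)

  length-prefixed : ∀ π w i xss → length (prefixed π w i xss) ≡ length (ifReaches w i xss)
  length-prefixed π w i xss =
    trans (cong length (ifReaches-map w i (π ++_) xss)) (length-map (π ++_) (ifReaches w i xss))

  length-maxLasts : ∀ k h l → length (maxLasts k h l) ≡ length (ifReaches l 1 (framed k (shrink 1 h) (top 3)))
  length-maxLasts k h l = trans (cong length (ifReaches-map l 1 (_∷ʳ k) (framed k (shrink 1 h) (top 3))))
                                (length-map (_∷ʳ k) (ifReaches l 1 (framed k (shrink 1 h) (top 3))))

  count-step : ∀ j h l → count (3 + j) h l ≡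
    length (ifReaches h 1 (framed (2 + j) (top 3) (shrink 1 l))) +
    (length (ifReaches h 2 (framed (suc j) (top 2) (shrink 2 l))) +
    (length (ifReaches h 2 (framed j (top 1) (shrink 3 l))) +
    (length (ifReaches h 3 (framed j (top 1) (shrink 3 l))) +
    length (ifReaches l 1 (framed (2 + j) (shrink 1 h) (top 3))))))
  count-step j h l = begin
    length (F ++ (R ++ FR ++ RR) ++ L)     ≡⟨ cong (λ xs → length (F ++ xs)) (trans (++-assoc R (FR ++ RR) L)
                                                                               (cong (R ++_) (++-assoc FR RR L))) ⟩
    length (F ++ R ++ FR ++ RR ++ L)       ≡⟨ length-++ F ⟩
    ∣F∣ + length (R ++ FR ++ RR ++ L)     ≡⟨ cong (∣F∣ +_) (length-++ R) ⟩
    ∣F∣ + (∣R∣ + length (FR ++ RR ++ L))  ≡⟨ cong (λ n → ∣F∣ + (∣R∣ + n)) (length-++ FR) ⟩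
    ∣F∣ + (∣R∣ + (∣FR∣ + length (RR ++ L))) ≡⟨ cong (λ n → ∣F∣ + (∣R∣ + (∣FR∣ + n))) (length-++ RR) ⟩
    ∣F∣ + (∣R∣ + (∣FR∣ + (∣RR∣ + ∣L∣)))   ≡⟨ cong₂ _+_ (length-prefixed _ h 1 _)
                                              (cong₂ _+_ (length-prefixed _ h 2 _)
                                              (cong₂ _+_ (length-prefixed _ h 2 _)
                                              (cong₂ _+_ (length-prefixed _ h 3 _) (length-maxLasts (2 + j) h l)))) ⟩
    _ ∎
    where
    open ≡-Reasoning
    F R FR RR L : List (List ℕ)
    F  = maxFirsts (2 + j) h l
    R  = rises (2 + j) h l
    FR = fallRises (2 + j) h l
    RR = riseRises (2 + j) h l
    L  = maxLasts (2 + j) h l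
    ∣F∣ ∣R∣ ∣FR∣ ∣RR∣ ∣L∣ : ℕ
    ∣F∣  = length F
    ∣R∣  = length R
    ∣FR∣ = length FR
    ∣RR∣ = length RR
    ∣L∣  = length L

  all∉⇒[] : ∀ {xs : List A} → (∀ {x} → x ∉ xs) → xs ≡ []
  all∉⇒[] {xs = []}    _  = refl
  all∉⇒[] {xs = x ∷ _} ∉ = contradiction (here refl) ∉

  ¬Framed-top0ˡ : ¬ Framed k (top 0) l σ
  ¬Framed-top0ˡ {σ = []}    F = starts F
  ¬Framed-top0ˡ {σ = x ∷ _} F = <⇒≱ (proj₂ (bounds (arranges F) (here refl))) (starts F)

  ¬Framed-top0ʳ : ¬ Framed k h (top 0) σ
  ¬Framed-top0ʳ {σ = σ} F with x , x∈σ , k≤x ← Last⇒∈ σ (ends F) =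
    <⇒≱ (proj₂ (bounds (arranges F) x∈σ)) k≤x

  count-top0ˡ : ∀ k l → count k (top 0) l ≡ 0
  count-top0ˡ k l = cong length (all∉⇒[] (¬Framed-top0ˡ ∘ framed-sound k))

  count-top0ʳ : ∀ k h → count k h (top 0) ≡ 0
  count-top0ʳ k h = cong length (all∉⇒[] (¬Framed-top0ʳ ∘ framed-sound k))

  -- The windowed counts reached from (whole, whole) by count-step, at sizes m + 2, m + 1 and m.
  -- Row i of `transitions` lists the entries of `states m` that sum to entry i of
  -- `states (suc m)`, once the empty classes with a window `top 0` are dropped.
  states : ℕ → Vec ℕ 14
  states m =
    count (2 + m) whole whole ∷ count (2 + m) whole (top 3) ∷ count (2 + m) (top 1) whole ∷
    count (2 + m) (top 1) (top 3) ∷ count (2 + m) (top 2) whole ∷ count (2 + m) (top 2) (top 1) ∷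
    count (2 + m) (top 2) (top 3) ∷ count (2 + m) (top 3) whole ∷ count (2 + m) (top 3) (top 1) ∷
    count (2 + m) (top 3) (top 2) ∷ count (1 + m) (top 2) whole ∷ count (1 + m) (top 2) (top 1) ∷
    count (1 + m) (top 1) whole ∷ count m (top 1) whole ∷ []

  transitions : Vec (List⁺ (Fin 14)) 14
  transitions =
    (# 7 ∷ # 10 ∷ # 13 ∷ # 13 ∷ # 1 ∷ []) ∷ (# 9 ∷ # 11 ∷ # 1 ∷ []) ∷ (# 7 ∷ []) ∷ (# 9 ∷ []) ∷
    (# 7 ∷ # 10 ∷ # 13 ∷ # 3 ∷ []) ∷ (# 3 ∷ []) ∷ (# 9 ∷ # 11 ∷ # 3 ∷ []) ∷
    (# 7 ∷ # 10 ∷ # 13 ∷ # 13 ∷ # 6 ∷ []) ∷ (# 6 ∷ []) ∷ (# 8 ∷ # 6 ∷ []) ∷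
    (# 4 ∷ []) ∷ (# 5 ∷ []) ∷ (# 2 ∷ []) ∷ (# 12 ∷ []) ∷ []

  states-step : ∀ m → states (suc m) ≡ transfer transitions _+_ (states m)
  states-step m
    rewrite count-step m whole whole   | count-step m whole (top 3)   | count-step m (top 1) whole
          | count-step m (top 1) (top 3) | count-step m (top 2) whole   | count-step m (top 2) (top 1)
          | count-step m (top 2) (top 3) | count-step m (top 3) whole   | count-step m (top 3) (top 1)
          | count-step m (top 3) (top 2)
          | count-top0ʳ m (top 1) | count-top0ʳ (1 + m) (top 2) | count-top0ʳ (2 + m) (top 3)
          | count-top0ˡ (2 + m) (top 3)
          | +-identityʳ (count (2 + m) (top 3) whole) | +-identityʳ (count (2 + m) (top 3) (top 2)) = refl

  states-fold : ∀ m t → states (m + t) ≡ fold (states m) (transfer transitions _+_) t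
  states-fold m zero    = cong states (+-identityʳ m)
  states-fold m (suc t) = begin
    states (m + suc t)                                ≡⟨ cong states (+-suc m t) ⟩
    states (suc (m + t))                              ≡⟨ states-step (m + t) ⟩
    transfer transitions _+_ (states (m + t))         ≡⟨ cong (transfer transitions _+_) (states-fold m t) ⟩
    transfer transitions _+_ (fold (states m) _ t)    ∎
    where open ≡-Reasoning

module GeneratingFunction where

  open import Data.Fin.Base using (zero)
  open import Data.Integer.Base using (ℤ; +_; -_; _+_; _-_; _*_)
  open import Data.Integer.Properties using (pos-+; +-identityʳ; i-j≡0⇒i≡j; _≟_)
  open import Data.Integer.Solver using (module +-*-Solver)
  open import Data.List.Base using (List; []; _∷_; length; upTo)
  open import Data.List.Membership.Propositional.Properties using (∈-upTo⁺)
  open import Data.List.Relation.Unary.All using (All; all?)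
  import Data.List.Relation.Unary.All as All
  open import Data.Nat.Base as ℕ using (ℕ; zero; suc; _≤_; _∸_; s≤s)
  open import Data.Nat.GeneralisedArithmetic using (fold)
  open import Data.Nat.Properties using (≤-refl; m≤n⇒∃[o]m+o≡n; ≮⇒≥; _<?_; +-comm; +-suc)
  open import Data.Product using (_,_)
  open import Data.Vec.Base using (Vec; []; _∷_; head; map; replicate; zipWith)
  open import Data.Vec.Properties using (map-∘; map-cong; ≡-dec)
  open import Function using (_∘_)
  open import Relation.Binary.PropositionalEquality
  open import Relation.Nullary.Decidable using (yes; no; from-yes)
  open +-*-Solver
  open Transfer using (transfer; transfer-hom)
  open Enumeration using (validPerms; states; states-fold; transitions)

  private variable
    n : ℕ

  infixl 6 _+ᵛ_
  infixl 7 _*ᵛ_ _·_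

  _·_ : Vec ℤ n → Vec ℤ n → ℤ
  []      · []      = + 0
  (a ∷ u) · (b ∷ v) = a * b + u · v

  _+ᵛ_ : Vec ℤ n → Vec ℤ n → Vec ℤ n
  _+ᵛ_ = zipWith _+_

  _*ᵛ_ : ℤ → Vec ℤ n → Vec ℤ n
  c *ᵛ u = map (c *_) u

  0ᵛ : Vec ℤ n
  0ᵛ = replicate _ (+ 0)

  0ᵛ-· : ∀ (v : Vec ℤ n) → 0ᵛ · v ≡ + 0
  0ᵛ-· []      = refl
  0ᵛ-· (b ∷ v) =
    trans (cong (_+_ (+ 0 * b)) (0ᵛ-· v)) (solve 1 (λ b → con (+ 0) :* b :+ con (+ 0) := con (+ 0)) refl b)

  +ᵛ-· : ∀ (u w v : Vec ℤ n) → (u +ᵛ w) · v ≡ u · v + w · v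
  +ᵛ-· []      []      []      = refl
  +ᵛ-· (a ∷ u) (c ∷ w) (b ∷ v) = trans (cong (_+_ ((a + c) * b)) (+ᵛ-· u w v))
    (solve 5 (λ a c b U W → (a :+ c) :* b :+ (U :+ W) := a :* b :+ U :+ (c :* b :+ W)) refl a c b (u · v) (w · v))

  *ᵛ-· : ∀ c (u v : Vec ℤ n) → (c *ᵛ u) · v ≡ c * (u · v)
  *ᵛ-· c []      []      = solve 1 (λ c → con (+ 0) := c :* con (+ 0)) refl c
  *ᵛ-· c (a ∷ u) (b ∷ v) = trans (cong (_+_ (c * a * b)) (*ᵛ-· c u v))
    (solve 4 (λ c a b U → c :* a :* b :+ c :* U := c :* (a :* b :+ U)) refl c a b (u · v))

  identity : Vec (Vec ℤ n) n
  identity {zero}  = []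
  identity {suc n} = (+ 1 ∷ 0ᵛ) ∷ map (+ 0 ∷_) identity

  identity-· : ∀ (v : Vec ℤ n) → map (_· v) identity ≡ v
  identity-· []      = refl
  identity-· (b ∷ v) = cong₂ _∷_
    (trans (cong (_+_ (+ 1 * b)) (0ᵛ-· v)) (solve 1 (λ b → con (+ 1) :* b :+ con (+ 0) := b) refl b))
    (trans (sym (map-∘ (_· (b ∷ v)) (+ 0 ∷_) identity))
           (trans (map-cong (λ f → solve 2 (λ b F → con (+ 0) :* b :+ F := F) refl b (f · v)) identity)
                  (identity-· v)))

  powers : ℕ → Vec (Vec ℤ 14) 14
  powers zero    = identity
  powers (suc t) = transfer transitions _+ᵛ_ (powers t)

  powers-· : ∀ t (v : Vec ℤ 14) → map (_· v) (powers t) ≡ fold v (transfer transitions _+_) t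
  powers-· zero    v = identity-· v
  powers-· (suc t) v = trans (transfer-hom transitions {_+ᵛ_} {_+_} (_· v) (λ f g → +ᵛ-· f g v) (powers t))
                             (cong (transfer transitions _+_) (powers-· t v))

  map-pos-fold : ∀ t (v : Vec ℕ 14) →
                 map +_ (fold v (transfer transitions ℕ._+_) t) ≡ fold (map +_ v) (transfer transitions _+_) t
  map-pos-fold zero    v = refl
  map-pos-fold (suc t) v =
    trans (transfer-hom transitions {ℕ._+_} {_+_} +_ pos-+ (fold v (transfer transitions ℕ._+_) t))
          (cong (transfer transitions _+_) (map-pos-fold t v))

  convᵛ : List ℤ → (ℕ → Vec ℤ n) → ℕ → Vec ℤ n
  convᵛ []       F k       = 0ᵛ
  convᵛ (d ∷ ds) F zero    = d *ᵛ F zero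
  convᵛ (d ∷ ds) F (suc k) = d *ᵛ F (suc k) +ᵛ convᵛ ds F k

  conv-· : ∀ ds (F : ℕ → Vec ℤ n) k v → conv ds (λ t → F t · v) k ≡ convᵛ ds F k · v
  conv-· []       F k       v = sym (0ᵛ-· v)
  conv-· (d ∷ ds) F zero    v = sym (*ᵛ-· d (F zero) v)
  conv-· (d ∷ ds) F (suc k) v = trans (cong₂ _+_ (sym (*ᵛ-· d (F (suc k)) v)) (conv-· ds F k v))
                                      (sym (+ᵛ-· (d *ᵛ F (suc k)) (convᵛ ds F k) v))

  conv-cong : ∀ ds {f g : ℕ → ℤ} → (∀ k → f k ≡ g k) → ∀ k → conv ds f k ≡ conv ds g k
  conv-cong []       f≗g k       = refl
  conv-cong (d ∷ ds) f≗g zero    = cong (d *_) (f≗g zero)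
  conv-cong (d ∷ ds) f≗g (suc k) = cong₂ _+_ (cong (d *_) (f≗g (suc k))) (conv-cong ds f≗g k)

  conv-shift : ∀ ds (f : ℕ → ℤ) k c → length ds ≤ suc k → conv ds f (k ℕ.+ c) ≡ conv ds (λ t → f (t ℕ.+ c)) k
  conv-shift []           f k       c       _         = refl
  conv-shift (d ∷ [])     f zero    zero    _         = refl
  conv-shift (d ∷ [])     f zero    (suc c) _         = +-identityʳ (d * f (suc c))
  conv-shift (d ∷ e ∷ ds) f zero    c       (s≤s ())
  conv-shift (d ∷ ds)     f (suc k) c       (s≤s ≤k)  = cong (_+_ (d * f (suc (k ℕ.+ c)))) (conv-shift ds f k c ≤k)

  firstRow : ℕ → Vec ℤ 14
  firstRow t = head (powers (suc t))

  -- D₃ annihilates the first rows of the powers only from the first power on, hence the shift by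
  -- one here and the start at 16 in gf-tail.  Deciding the equality is much cheaper than `refl`.
  D3-annihilates : convᵛ D3 firstRow 13 ≡ 0ᵛ
  D3-annihilates = from-yes (≡-dec _≟_ (convᵛ D3 firstRow 13) 0ᵛ)

  a-fast : ℕ → ℤ
  a-fast zero          = + 1
  a-fast (suc zero)    = + 1
  a-fast (suc (suc t)) = + head (fold (states 0) (transfer transitions ℕ._+_) t)

  gf-head : All (λ k → conv D3 a-fast k ≡ coeff N3 k) (upTo 16)
  gf-head = from-yes (all? (λ k → conv D3 a-fast k ≟ coeff N3 k) (upTo 16))

  module _ (f : ℕ → ℤ) (f0 : f 0 ≡ + 1) (f1 : f 1 ≡ + 1) (f2+ : ∀ t → f (2 ℕ.+ t) ≡ + head (states t)) where

    f-states : ∀ m t → f (t ℕ.+ (2 ℕ.+ m)) ≡ head (powers t) · map +_ (states m)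
    f-states m t = begin
      f (t ℕ.+ (2 ℕ.+ m))                        ≡⟨ cong f (+-comm t (2 ℕ.+ m)) ⟩
      f (2 ℕ.+ (m ℕ.+ t))                        ≡⟨ f2+ (m ℕ.+ t) ⟩
      + head (states (m ℕ.+ t))                  ≡⟨ cong (+_ ∘ head) (states-fold m t) ⟩
      + head (fold (states m) stepℕ t)           ≡⟨ head-map +_ (fold (states m) stepℕ t) ⟩
      head (map +_ (fold (states m) stepℕ t))    ≡⟨ cong head (map-pos-fold t (states m)) ⟩
      head (fold y (transfer transitions _+_) t) ≡⟨ cong head (powers-· t y) ⟨
      head (map (_· y) (powers t))               ≡⟨ head-map (_· y) (powers t) ⟨
      head (powers t) · y                        ∎
      where
      open ≡-Reasoning
      stepℕ : Vec ℕ 14 → Vec ℕ 14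
      stepℕ = transfer transitions ℕ._+_
      y : Vec ℤ 14
      y = map +_ (states m)
      head-map : ∀ {A B : Set} (g : A → B) (v : Vec A (suc n)) → g (head v) ≡ head (map g v)
      head-map g (x ∷ v) = refl

    gf-tail : ∀ m → conv D3 f (16 ℕ.+ m) ≡ + 0
    gf-tail m = begin
      conv D3 f (13 ℕ.+ (3 ℕ.+ m))           ≡⟨ conv-shift D3 f 13 (3 ℕ.+ m) ≤-refl ⟩
      conv D3 (λ t → f (t ℕ.+ (3 ℕ.+ m))) 13 ≡⟨ conv-cong D3 shifted 13 ⟩
      conv D3 (λ t → firstRow t · y) 13      ≡⟨ conv-· D3 firstRow 13 y ⟩
      convᵛ D3 firstRow 13 · y               ≡⟨ cong (_· y) D3-annihilates ⟩
      0ᵛ · y                                 ≡⟨ 0ᵛ-· y ⟩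
      + 0                                    ∎
      where
      open ≡-Reasoning
      y : Vec ℤ 14
      y = map +_ (states m)
      shifted : ∀ t → f (t ℕ.+ (3 ℕ.+ m)) ≡ firstRow t · y
      shifted t = trans (cong f (+-suc t (2 ℕ.+ m))) (f-states m (suc t))

    f≗a-fast : ∀ k → f k ≡ a-fast k
    f≗a-fast zero          = f0
    f≗a-fast (suc zero)    = f1
    f≗a-fast (suc (suc t)) = trans (f2+ t) (cong (+_ ∘ head) (states-fold 0 t))

    gf-identity : ∀ k → conv D3 f k ≡ coeff N3 k
    gf-identity k with k <? 16
    ... | yes k<16 = trans (conv-cong D3 f≗a-fast k) (All.lookup gf-head (∈-upTo⁺ k<16))
    ... | no  k≮16 = let m , 16+m≡k = m≤n⇒∃[o]m+o≡n (≮⇒≥ k≮16) in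
                     subst (λ k → conv D3 f k ≡ coeff N3 k) 16+m≡k (gf-tail m)

  recurrence-rhs : (ℕ → ℤ) → ℕ → ℤ
  recurrence-rhs f n =
    + 2 * f (n ∸ 1) + f (n ∸ 2) - f (n ∸ 3) - f (n ∸ 4) - + 2 * f (n ∸ 5) - + 2 * f (n ∸ 6)
    - + 2 * f (n ∸ 7) + + 4 * f (n ∸ 8) + + 2 * f (n ∸ 9) - f (n ∸ 10) + + 2 * f (n ∸ 11) - f (n ∸ 13)

  conv-D3-13 : ∀ (g : ℕ → ℤ) → conv D3 g 13 ≡ g 13 - recurrence-rhs g 13
  conv-D3-13 g = solve 14
    (λ x₀ x₁ x₂ x₃ x₄ x₅ x₆ x₇ x₈ x₉ x₁₀ x₁₁ x₁₂ x₁₃ →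
      con (+ 1) :* x₁₃ :+ (con (- + 2) :* x₁₂ :+ (con (- + 1) :* x₁₁ :+ (con (+ 1) :* x₁₀ :+
      (con (+ 1) :* x₉ :+ (con (+ 2) :* x₈ :+ (con (+ 2) :* x₇ :+ (con (+ 2) :* x₆ :+
      (con (- + 4) :* x₅ :+ (con (- + 2) :* x₄ :+ (con (+ 1) :* x₃ :+ (con (- + 2) :* x₂ :+
      (con (+ 0) :* x₁ :+ con (+ 1) :* x₀))))))))))))
      := x₁₃ :- (con (+ 2) :* x₁₂ :+ x₁₁ :- x₁₀ :- x₉ :- con (+ 2) :* x₈ :- con (+ 2) :* x₇
                 :- con (+ 2) :* x₆ :+ con (+ 4) :* x₅ :+ con (+ 2) :* x₄ :- x₃ :+ con (+ 2) :* x₂ :- x₀))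
    refl (g 0) (g 1) (g 2) (g 3) (g 4) (g 5) (g 6) (g 7) (g 8) (g 9) (g 10) (g 11) (g 12) (g 13)

  recurrence : (f : ℕ → ℤ) → (∀ k → conv D3 f k ≡ coeff N3 k) → ∀ n → 13 ≤ n → f n ≡ recurrence-rhs f n
  recurrence f gf n 13≤n = let m , 13+m≡n = m≤n⇒∃[o]m+o≡n 13≤n in
    subst (λ n → f n ≡ recurrence-rhs f n) 13+m≡n (i-j≡0⇒i≡j _ _ (begin
      f (13 ℕ.+ m) - recurrence-rhs f (13 ℕ.+ m) ≡⟨ conv-D3-13 (λ t → f (t ℕ.+ m)) ⟨
      conv D3 (λ t → f (t ℕ.+ m)) 13             ≡⟨ conv-shift D3 f 13 m ≤-refl ⟨
      conv D3 f (13 ℕ.+ m)                       ≡⟨ gf (13 ℕ.+ m) ⟩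
      + 0                                        ∎))
    where open ≡-Reasoning

open import Data.Nat using (ℕ; suc; _≤_; _∸_)
open import Data.List using (List; length)
open import Data.List.Membership.Propositional using (_∈_)
open import Data.List.Membership.Propositional.Properties.WithK using (unique∧set⇒bag)
open import Data.List.Relation.Binary.BagAndSetEquality using (∼bag⇒↭)
open import Data.List.Relation.Binary.Permutation.Propositional.Properties using (↭-length)
open import Data.List.Relation.Unary.Unique.Propositional using (Unique)
open import Data.Integer using (ℤ; +_; _+_; _-_; _*_)
open import Data.Product using (_×_; _,_)
open import Function using (_∘_)
open import Function.Bundles using (_⇔_)
import Function.Properties.Equivalence as ⇔
open import Relation.Binary.PropositionalEquality using (_≡_; cong)
open Enumeration using (validPerms; validPerms-unique; ∈-validPerms)
open GeneratingFunction using (gf-identity; recurrence)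

length-unique : ∀ {A : Set} {xs ys : List A} → Unique xs → Unique ys → (∀ {x} → x ∈ xs ⇔ x ∈ ys) →
                length xs ≡ length ys
length-unique ux uy xs⇔ys = ↭-length (∼bag⇒↭ (unique∧set⇒bag ux uy xs⇔ys))

mainTheorem14 : (L : ℕ → List (List ℕ))
    → (∀ n → Unique (L n))
    → (∀ n σ → (σ ∈ L n) ⇔ Valid 3 n σ)
    → ((n : ℕ) → conv D3 (λ k → + length (L k)) n ≡ coeff N3 n)
      × ((n : ℕ) → 13 ≤ n →
          + length (L n) ≡
            + 2 * + length (L (n ∸ 1)) + + length (L (n ∸ 2)) - + length (L (n ∸ 3))
            - + length (L (n ∸ 4)) - + 2 * + length (L (n ∸ 5)) - + 2 * + length (L (n ∸ 6))
            - + 2 * + length (L (n ∸ 7)) + + 4 * + length (L (n ∸ 8)) + + 2 * + length (L (n ∸ 9))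
            - + length (L (n ∸ 10)) + + 2 * + length (L (n ∸ 11)) - + length (L (n ∸ 13)))
mainTheorem14 L U M = gf , recurrence f gf
  where
  f : ℕ → ℤ
  f k = + length (L k)
  length-L : ∀ k → length (L k) ≡ length (validPerms k)
  length-L k = length-unique (U k) (validPerms-unique k) (λ {σ} → ⇔.trans (M k σ) (⇔.sym (∈-validPerms k)))
  gf : ∀ n → conv D3 f n ≡ coeff N3 n
  gf = gf-identity f (cong +_ (length-L 0)) (cong +_ (length-L 1)) (cong +_ ∘ length-L ∘ suc ∘ suc)
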